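{- Let $G=(V,E)$ be a finite graph with maximum degree $\Delta$ and let $D=\Delta+1$. Let $\chi:V\to\{1,\dots,D\}$ be a coloring that is not proper, and let $v$ be any conflicted vertex under $\chi$ (possibly chosen adversarially). Let $\chi'$ be the coloring obtained from $\chi$ by changing the color of $v$ to a uniformly random color in $\{1,\dots,D\}$ (all other colors unchanged). Then \[\mathbb{E}[\Phi(\chi')-\Phi(\chi)]\ \ge\ \frac1D,\] where the expectation is over the random new color of $v$. Equivalently, in the Decentralized Coloring process, for every $t>0$, $\mathbb{E}[\Phi(\chi_t)-\Phi(\chi_{t-1}) \mid \chi_{t-1}\text{ invalid}]\ge 1/D$, where $\chi_t$ is the coloring after the $t$-th recoloring.
   Context: A vertex $v$ is conflicted under $\chi$ if some neighbor $u$ has $\chi(u)=\chi(v)$; $\chi$ is valid (proper) iff no vertex is conflicted. For a coloring $\chi$, $\Phi(\chi)$ denotes the number of monochromatic connected components of $G$ under $\chi$, i.e. the total, over all colors $c$, of the number of connected components of the subgraph of $G$ induced by $\chi^{ -1}(c)$. In the Decentralized Coloring process, at each step a conflicted vertex (possibly chosen adversarially) is recolored once to an independent uniformly random color in $\{1,\dots,D\}$. -}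

module Defs where

open import Data.Nat using (ℕ; suc; _≤_; _≤?_)
open import Data.Fin using (Fin; toℕ; _≟_)
open import Data.List using (List; length; filter; map; sum; allFin)
open import Data.Integer as ℤ using (ℤ; +_; _-_)
open import Data.Product using (Σ; _×_; ∃)
open import Relation.Nullary using (Dec; yes; no; ¬_)
open import Relation.Nullary.Decidable using (_→-dec_)
open import Relation.Binary.PropositionalEquality using (_≡_)
open import Data.Fin.Properties using (all?)
import Data.Integer as Z

record Graph (n : ℕ) : Set₁ where
  field
    Adj   : Fin n → Fin n → Set
    adj?  : ∀ u w → Dec (Adj u w)
    sym   : ∀ {u w} → Adj u w → Adj w u
    irrefl : ∀ {u} → ¬ Adj u u
open Graph public

degree : ∀ {n} → Graph n → Fin n → ℕ
degree G v = length (filter (adj? G v) (allFin _))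

IsMaxDegree : ∀ {n} → Graph n → ℕ → Set
IsMaxDegree G Δ = (∀ v → degree G v ≤ Δ) × ∃ (λ v → degree G v ≡ Δ)

Coloring : ℕ → ℕ → Set
Coloring n D = Fin n → Fin D

Conflicted : ∀ {n D} → Graph n → Coloring n D → Fin n → Set
Conflicted G χ v = ∃ (λ u → Adj G v u × χ u ≡ χ v)

Proper : ∀ {n D} → Graph n → Coloring n D → Set
Proper G χ = ∀ v → ¬ Conflicted G χ v

data MonoPath {n D} (G : Graph n) (χ : Coloring n D) : Fin n → Fin n → Set where
  here : ∀ {u} → MonoPath G χ u u
  step : ∀ {u x w} → Adj G u x → χ u ≡ χ x → MonoPath G χ x w → MonoPath G χ u w

IsRep : ∀ {n D} → Graph n → Coloring n D → Fin n → Set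
IsRep G χ u = ∀ w → MonoPath G χ u w → toℕ u ≤ toℕ w

-- Φ(χ): number of monochromatic connected components, counted via their
-- least-index representatives.  It is parameterised by a decision procedure
-- for MonoPath; the value does not depend on which decider is used.
Φ : ∀ {n D} (G : Graph n) →
    (path? : ∀ (χ : Coloring n D) u w → Dec (MonoPath G χ u w)) →
    Coloring n D → ℕ
Φ {n} G path? χ =
  length (filter (λ u → all? (λ w → path? χ u w →-dec (toℕ u ≤? toℕ w))) (allFin n))

recolor : ∀ {n D} → Coloring n D → Fin n → Fin D → Coloring n D
recolor χ v c w with w ≟ v
... | yes _ = c
... | no  _ = χ w

sumColors : ∀ D → (Fin D → ℤ) → ℤ
sumColors D f = Data.List.foldr Z._+_ (+ 0) (map f (allFin D))

module Submission where

-- Let a = χ v, let x₀ be a neighbour of v of colour a, and write m(c) for the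
-- number of neighbours of v of colour c.  For c = a nothing changes.  For
-- c ≠ a we show Φ(χ) + 1 ≤ Φ(χ[v↦c]) + m(c) by an injection from the
-- χ-components into (χ[v↦c]-components) ⊎ (c-coloured neighbours of v)
-- that misses the new component of v: the component of v goes to the
-- component of x₀, a component meeting a c-coloured neighbour y goes to y,
-- and every other component is untouched by the recolouring.  Summing over
-- the Δ colours c ≠ a, and using Σ_{c≠a} m(c) = deg v − m(a) ≤ Δ − 1, gives
-- Σ_c Φ(χ[v↦c]) ≥ D·Φ(χ) + 1.

open import Defs
open import Data.Nat using (ℕ; suc)
open import Data.Fin using (Fin)
open import Relation.Nullary using (Dec; ¬_)
open import Data.Integer using (+_; _-_; _≤_)

open import Data.Nat as ℕ using (zero; _+_; _*_; z≤n; s≤s)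
import Data.Nat.Properties as ℕ
import Data.Nat.Tactic.RingSolver as ℕSolver
import Data.Integer as ℤ
import Data.Integer.Properties as ℤ
open import Data.Integer.Tactic.RingSolver using (solve-∀)
open import Data.Fin using (zero; suc; toℕ; _≟_; splitAt; join; punchIn)
open import Data.Fin.Properties using (toℕ-injective; splitAt-join; suc-injective; 0≢1+n; any?; all?; punchInᵢ≢i)
open import Data.Bool using (true; false; if_then_else_)
open import Data.Sum using (_⊎_; inj₁; inj₂; map₁)
open import Data.Sum.Properties using (inj₁-injective)
open import Data.Product using (∃; _×_; _,_; proj₁; proj₂)
open import Data.List using (length; filter; tabulate; foldr; allFin)
open import Data.List.Properties using (map-tabulate)
open import Relation.Nullary using (yes; no; does; contradiction)
open import Relation.Nullary.Decidable using (_×-dec_; _→-dec_; ¬?; does-⇔; dec-true)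
open import Relation.Unary using (Decidable)
open import Relation.Binary.PropositionalEquality as ≡
  using (_≡_; _≢_; refl; cong; cong₂; module ≡-Reasoning)
open import Function using (_∘_; id; mk⇔)
open import Algebra.Properties.CommutativeMonoid.Sum ℕ.+-0-commutativeMonoid
  using (sum-syntax; ∑-comm; ∑-distrib-+; sum-remove; sum-cong-≗; sum-replicate-zero)
open import Algebra.Properties.Semiring.Sum ℕ.+-*-semiring using (*-distribˡ-sum)

𝟙 : ∀ {A : Set} → Dec A → ℕ
𝟙 a? = if does a? then 1 else 0

count : ∀ {n} {P : Fin n → Set} → Decidable P → ℕ
count {n} P? = ∑[ i < n ] 𝟙 (P? i)

𝟙-× : ∀ {A B : Set} (a? : Dec A) (b? : Dec B) → 𝟙 (a? ×-dec b?) ≡ 𝟙 a? * 𝟙 b?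
𝟙-× a? b? with does a? | does b?
... | true  | true  = refl
... | true  | false = refl
... | false | _     = refl

count-length : ∀ {n} {P : Fin n → Set} (P? : Decidable P) →
  length (filter P? (allFin n)) ≡ count P?
count-length {n} P? = go n id
  where
  go : ∀ k (f : Fin k → Fin n) → length (filter P? (tabulate f)) ≡ count (P? ∘ f)
  go zero    f = refl
  go (suc k) f with does (P? (f zero))
  ... | true  = cong suc (go k (f ∘ suc))
  ... | false = go k (f ∘ suc)

count-cong : ∀ {n} {P Q : Fin n → Set} (P? : Decidable P) (Q? : Decidable Q) →
  (∀ i → P i → Q i) → (∀ i → Q i → P i) → count P? ≡ count Q?
count-cong P? Q? P⇒Q Q⇒P =
  sum-cong-≗ (λ i → cong (λ b → if b then 1 else 0) (does-⇔ (mk⇔ (P⇒Q i) (Q⇒P i)) (P? i) (Q? i)))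

_∖_ : ∀ {n} {Q : Fin n → Set} → Decidable Q → (j : Fin n) → Decidable (λ x → Q x × x ≢ j)
(Q? ∖ j) x = Q? x ×-dec ¬? (x ≟ j)

count-remove : ∀ {n} {Q : Fin n → Set} (Q? : Decidable Q) (j : Fin n) → Q j →
  count Q? ≡ suc (count (Q? ∖ j))
count-remove {suc n} Q? zero qj
  rewrite dec-true (Q? zero) qj =
    cong suc (sum-cong-≗ λ i → ≡.trans (≡.sym (ℕ.*-identityʳ (𝟙 (Q? (suc i))))) (≡.sym (𝟙-× (Q? (suc i)) (¬? (suc i ≟ zero)))))
count-remove {suc n} Q? (suc j) qj
  rewrite 𝟙-× (Q? zero) (¬? (zero ≟ suc j)) | ℕ.*-identityʳ (𝟙 (Q? zero)) =
    ≡.trans (cong (_+_ (𝟙 (Q? zero))) (count-remove (Q? ∘ suc) j qj)) (ℕ.+-suc (𝟙 (Q? zero)) _)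

count-pos : ∀ {n} {Q : Fin n → Set} (Q? : Decidable Q) (j : Fin n) → Q j → 1 ℕ.≤ count Q?
count-pos Q? j qj rewrite count-remove Q? j qj = s≤s z≤n

count-injection : ∀ {k l} {P : Fin k → Set} {Q : Fin l → Set}
  (P? : Decidable P) (Q? : Decidable Q) (f : Fin k → Fin l) →
  (∀ {i} → P i → Q (f i)) → (∀ {i j} → P i → P j → f i ≡ f j → i ≡ j) →
  count P? ℕ.≤ count Q?
count-injection {zero}  P? Q? f into inj = z≤n
count-injection {suc k} P? Q? f into inj with P? zero
... | no _ = count-injection (P? ∘ suc) Q? (f ∘ suc) into (λ p q e → suc-injective (inj p q e))
... | yes p₀ rewrite count-remove Q? (f zero) (into p₀) =
  s≤s (count-injection (P? ∘ suc) (Q? ∖ f zero) (f ∘ suc)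
    (λ p → into p , λ e → 0≢1+n (≡.sym (inj p p₀ e)))
    (λ p q e → suc-injective (inj p q e)))

count-injection-avoiding : ∀ {k l} {P : Fin k → Set} {Q : Fin l → Set}
  (P? : Decidable P) (Q? : Decidable Q) (f : Fin k → Fin l) (s : Fin l) →
  (∀ {i} → P i → Q (f i)) → (∀ {i j} → P i → P j → f i ≡ f j → i ≡ j) →
  Q s → (∀ {i} → P i → f i ≢ s) → suc (count P?) ℕ.≤ count Q?
count-injection-avoiding P? Q? f s into inj qs miss
  rewrite count-remove Q? s qs =
    s≤s (count-injection P? (Q? ∖ s) f (λ p → into p , miss p) inj)

count-splitAt : ∀ l {m} {Q : Fin l ⊎ Fin m → Set} (Q? : Decidable Q) →
  count (Q? ∘ splitAt l) ≡ count (Q? ∘ inj₁) + count (Q? ∘ inj₂)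
count-splitAt zero    Q? = refl
count-splitAt (suc l) Q? =
  ≡.trans (cong (_+_ (𝟙 (Q? (inj₁ zero)))) (count-splitAt l (Q? ∘ map₁ suc)))
        (≡.sym (ℕ.+-assoc (𝟙 (Q? (inj₁ zero))) _ _))

count-injection-avoiding-⊎ : ∀ {k l m} {P : Fin k → Set} {Q : Fin l ⊎ Fin m → Set}
  (P? : Decidable P) (Q? : Decidable Q) (f : Fin k → Fin l ⊎ Fin m) (s : Fin l ⊎ Fin m) →
  (∀ {i} → P i → Q (f i)) → (∀ {i j} → P i → P j → f i ≡ f j → i ≡ j) →
  Q s → (∀ {i} → P i → f i ≢ s) →
  suc (count P?) ℕ.≤ count (Q? ∘ inj₁) + count (Q? ∘ inj₂)
count-injection-avoiding-⊎ {l = l} {m} {Q = Q} P? Q? f s into inj qs miss =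
  ℕ.≤-trans
    (count-injection-avoiding P? (Q? ∘ splitAt l) (join l m ∘ f) (join l m s)
      (λ {i} p → along-join (f i) (into p))
      (λ p q e → inj p q (join-injective e))
      (along-join s qs)
      (λ p e → miss p (join-injective e)))
    (ℕ.≤-reflexive (count-splitAt l Q?))
  where
  along-join : ∀ t → Q t → Q (splitAt l (join l m t))
  along-join t q rewrite splitAt-join l m t = q
  join-injective : ∀ {t u} → join l m t ≡ join l m u → t ≡ u
  join-injective {t} {u} e =
    ≡.trans (≡.sym (splitAt-join l m t)) (≡.trans (cong (splitAt l) e) (splitAt-join l m u))

sum-mono : ∀ {n} (f g : Fin n → ℕ) → (∀ i → f i ℕ.≤ g i) → ∑[ i < n ] f i ℕ.≤ ∑[ i < n ] g i
sum-mono {zero}  f g f≤g = z≤n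
sum-mono {suc n} f g f≤g = ℕ.+-mono-≤ (f≤g zero) (sum-mono (f ∘ suc) (g ∘ suc) (f≤g ∘ suc))

sum-const : ∀ n k → ∑[ i < n ] k ≡ n * k
sum-const zero    k = refl
sum-const (suc n) k = cong (_+_ k) (sum-const n k)

sum-𝟙-≡ : ∀ {D} (d : Fin D) → ∑[ c < D ] 𝟙 (d ≟ c) ≡ 1
sum-𝟙-≡ {suc D} zero    = cong suc (sum-replicate-zero D)
sum-𝟙-≡ {suc D} (suc d) = sum-𝟙-≡ d

count-by-colour : ∀ {n D} {P : Fin n → Set} (P? : Decidable P) (χ : Fin n → Fin D) →
  ∑[ c < D ] count (λ y → P? y ×-dec (χ y ≟ c)) ≡ count P?
count-by-colour {n} {D} P? χ = begin
  ∑[ c < D ] ∑[ y < n ] 𝟙 (P? y ×-dec (χ y ≟ c))  ≡⟨ ∑-comm (λ c y → 𝟙 (P? y ×-dec (χ y ≟ c))) ⟩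
  ∑[ y < n ] ∑[ c < D ] 𝟙 (P? y ×-dec (χ y ≟ c))  ≡⟨ sum-cong-≗ (λ y → sum-cong-≗ (λ c → 𝟙-× (P? y) (χ y ≟ c))) ⟩
  ∑[ y < n ] ∑[ c < D ] (𝟙 (P? y) * 𝟙 (χ y ≟ c))  ≡⟨ sum-cong-≗ (λ y → ≡.sym (*-distribˡ-sum (𝟙 (P? y)) (λ c → 𝟙 (χ y ≟ c)))) ⟩
  ∑[ y < n ] (𝟙 (P? y) * ∑[ c < D ] 𝟙 (χ y ≟ c))  ≡⟨ sum-cong-≗ (λ y → cong (_*_ (𝟙 (P? y))) (sum-𝟙-≡ (χ y))) ⟩
  ∑[ y < n ] (𝟙 (P? y) * 1)                        ≡⟨ sum-cong-≗ (λ y → ℕ.*-identityʳ (𝟙 (P? y))) ⟩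
  count P?                                         ∎
  where open ≡-Reasoning

sumColors-suc : ∀ D (f : Fin (suc D) → ℤ.ℤ) → sumColors (suc D) f ≡ f zero ℤ.+ sumColors D (f ∘ suc)
sumColors-suc D f =
  cong (λ xs → f zero ℤ.+ foldr ℤ._+_ (+ 0) xs)
    (≡.trans (map-tabulate suc f) (≡.sym (map-tabulate id (f ∘ suc))))

sumColors-diff : ∀ D (f : Fin D → ℕ) (k : ℕ) →
  sumColors D (λ c → + f c - + k) ≡ + (∑[ c < D ] f c) - + (D * k)
sumColors-diff zero    f k = refl
sumColors-diff (suc D) f k = begin
  sumColors (suc D) (λ c → + f c - + k)                          ≡⟨ sumColors-suc D (λ c → + f c - + k) ⟩
  (+ f zero - + k) ℤ.+ sumColors D (λ c → + f (suc c) - + k)     ≡⟨ cong (ℤ._+_ (+ f zero - + k)) (sumColors-diff D (f ∘ suc) k) ⟩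
  (+ f zero - + k) ℤ.+ (+ ∑[ c < D ] f (suc c) - + (D * k))      ≡⟨ regroup (+ f zero) (+ ∑[ c < D ] f (suc c)) (+ k) (+ (D * k)) ⟩
  (+ f zero ℤ.+ + ∑[ c < D ] f (suc c)) - (+ k ℤ.+ + (D * k))    ≡⟨ cong₂ _-_ (≡.sym (ℤ.pos-+ (f zero) _)) (≡.sym (ℤ.pos-+ k (D * k))) ⟩
  + (∑[ c < suc D ] f c) - + (suc D * k)                         ∎
  where
  open ≡-Reasoning
  regroup : ∀ (a b c d : ℤ.ℤ) → (a - c) ℤ.+ (b - d) ≡ (a ℤ.+ b) - (c ℤ.+ d)
  regroup = solve-∀

pos-difference : ∀ {x y} → y + 1 ℕ.≤ x → + 1 ≤ + x - + y
pos-difference {x} {y} y+1≤x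
  rewrite ℤ.m-n≡m⊖n x y | ℤ.⊖-≥ (ℕ.≤-trans (ℕ.m≤m+n y 1) y+1≤x) =
    ℤ.+≤+ (ℕ.m<n⇒0<n∸m (ℕ.≤-trans (ℕ.≤-reflexive (ℕ.+-comm 1 y)) y+1≤x))

module _ {n D} (G : Graph n) (χ : Coloring n D) where

  infixr 5 _++ᵖ_

  _++ᵖ_ : ∀ {u x w} → MonoPath G χ u x → MonoPath G χ x w → MonoPath G χ u w
  here           ++ᵖ q = q
  step u~x e p   ++ᵖ q = step u~x e (p ++ᵖ q)

  reverse : ∀ {u w} → MonoPath G χ u w → MonoPath G χ w u
  reverse here            = here
  reverse (step u~x e p)  = reverse p ++ᵖ step (sym G u~x) (≡.sym e) here

  path-colour : ∀ {u w} → MonoPath G χ u w → χ u ≡ χ w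
  path-colour here           = refl
  path-colour (step _ e p)   = ≡.trans e (path-colour p)

  rep-unique : ∀ {r₁ r₂} → IsRep G χ r₁ → IsRep G χ r₂ → MonoPath G χ r₁ r₂ → r₁ ≡ r₂
  rep-unique rep₁ rep₂ p = toℕ-injective (ℕ.≤-antisym (rep₁ _ p) (rep₂ _ (reverse p)))

path-transport : ∀ {n D} (G : Graph n) {χ₁ χ₂ : Coloring n D} → (∀ u → χ₁ u ≡ χ₂ u) →
  ∀ {u w} → MonoPath G χ₁ u w → MonoPath G χ₂ u w
path-transport G χ₁≗χ₂ here = here
path-transport G χ₁≗χ₂ (step {u = u} {x = x} u~x e p) =
  step u~x (≡.trans (≡.sym (χ₁≗χ₂ u)) (≡.trans e (χ₁≗χ₂ x))) (path-transport G χ₁≗χ₂ p)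

least : ∀ {n} {P : Fin n → Set} → Decidable P → ∃ P →
  ∃ λ w → P w × (∀ z → P z → toℕ w ℕ.≤ toℕ z)
least {suc n} P? (i , pi) with P? zero
... | yes p₀ = zero , p₀ , λ _ _ → z≤n
... | no ¬p₀ with i
...   | zero  = contradiction pi ¬p₀
...   | suc i′ with least (P? ∘ suc) (i′ , pi)
...     | w , pw , w-least = suc w , pw , λ
  { zero    pz → contradiction pz ¬p₀
  ; (suc z) pz → s≤s (w-least z pz) }

PathDecider : ∀ {n} → Graph n → ℕ → Set
PathDecider {n} G D = ∀ (χ : Coloring n D) u w → Dec (MonoPath G χ u w)

representative : ∀ {n D} (G : Graph n) → PathDecider G D → (χ : Coloring n D) (u : Fin n) →
  ∃ λ r → MonoPath G χ u r × IsRep G χ r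
representative G path? χ u with least (path? χ u) (u , here)
... | r , u⇝r , r-least = r , u⇝r , λ w r⇝w → r-least w (_++ᵖ_ G χ u⇝r r⇝w)

isRep? : ∀ {n D} (G : Graph n) → PathDecider G D → (χ : Coloring n D) → Decidable (IsRep G χ)
isRep? G path? χ u = all? (λ w → path? χ u w →-dec (toℕ u ℕ.≤? toℕ w))

Φ-count : ∀ {n D} (G : Graph n) (path? : PathDecider G D) (χ : Coloring n D) →
  Φ G path? χ ≡ count (isRep? G path? χ)
Φ-count G path? χ = count-length (isRep? G path? χ)

Φ-cong : ∀ {n D} (G : Graph n) (path? : PathDecider G D) {χ₁ χ₂ : Coloring n D} →
  (∀ u → χ₁ u ≡ χ₂ u) → Φ G path? χ₁ ≡ Φ G path? χ₂
Φ-cong G path? {χ₁} {χ₂} χ₁≗χ₂ = begin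
  Φ G path? χ₁                 ≡⟨ Φ-count G path? χ₁ ⟩
  count (isRep? G path? χ₁)   ≡⟨ count-cong (isRep? G path? χ₁) (isRep? G path? χ₂)
                                   (λ r rep w p → rep w (path-transport G (≡.sym ∘ χ₁≗χ₂) p))
                                   (λ r rep w p → rep w (path-transport G χ₁≗χ₂ p)) ⟩
  count (isRep? G path? χ₂)   ≡⟨ ≡.sym (Φ-count G path? χ₂) ⟩
  Φ G path? χ₂                 ∎
  where open ≡-Reasoning

recolor-at : ∀ {n D} (χ : Coloring n D) v c → recolor χ v c v ≡ c
recolor-at χ v c with v ≟ v
... | yes _   = refl
... | no v≢v  = contradiction refl v≢v

recolor-elsewhere : ∀ {n D} (χ : Coloring n D) v c {u} → u ≢ v → recolor χ v c u ≡ χ u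
recolor-elsewhere χ v c {u} u≢v with u ≟ v
... | yes u≡v = contradiction u≡v u≢v
... | no _    = refl

recolor-own : ∀ {n D} (χ : Coloring n D) v u → recolor χ v (χ v) u ≡ χ u
recolor-own χ v u with u ≟ v
... | yes refl = refl
... | no _     = refl

colourDegree : ∀ {n D} (G : Graph n) → Coloring n D → Fin n → Fin D → ℕ
colourDegree G χ v c = count (λ y → adj? G v y ×-dec (χ y ≟ c))

module RecolourStep {n D} (G : Graph n) (path? : PathDecider G D) (χ : Coloring n D)
  {v x₀ : Fin n} (v~x₀ : Adj G v x₀) (χx₀≡χv : χ x₀ ≡ χ v)
  {c : Fin D} (c≢χv : c ≢ χ v) where

  χ′ : Coloring n D
  χ′ = recolor χ v c

  NbrC : Fin n → Set
  NbrC y = Adj G v y × χ y ≡ c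

  edge-away-from-v : ∀ {u x} → u ≢ v → x ≢ v → χ′ u ≡ χ′ x → χ u ≡ χ x
  edge-away-from-v u≢v x≢v e =
    ≡.trans (≡.sym (recolor-elsewhere χ v c u≢v)) (≡.trans e (recolor-elsewhere χ v c x≢v))

  -- A χ′-path from u is a χ-path, or starts at v, or (cut just before it
  -- first enters v) shows that u is χ-connected to a c-coloured neighbour of v.
  recoloured-path : ∀ {u w} → MonoPath G χ′ u w →
    MonoPath G χ u w ⊎ u ≡ v ⊎ ∃ λ y → NbrC y × MonoPath G χ u y
  recoloured-path here = inj₁ here
  recoloured-path {u} {w} (step {x = x} u~x e p) = by-cases (u ≟ v) (x ≟ v)
    where
    by-cases : Dec (u ≡ v) → Dec (x ≡ v) → MonoPath G χ u w ⊎ u ≡ v ⊎ ∃ λ y → NbrC y × MonoPath G χ u y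
    by-cases (yes u≡v) _         = inj₂ (inj₁ u≡v)
    by-cases (no u≢v)  (yes x≡v) = inj₂ (inj₂ (u , (sym G (≡.subst (Adj G u) x≡v u~x) , χu≡c) , here))
      where
      χu≡c : χ u ≡ c
      χu≡c = ≡.trans (≡.sym (recolor-elsewhere χ v c u≢v))
               (≡.trans e (≡.trans (cong χ′ x≡v) (recolor-at χ v c)))
    by-cases (no u≢v)  (no x≢v) with recoloured-path p
    ... | inj₁ x⇝w                   = inj₁ (step u~x (edge-away-from-v u≢v x≢v e) x⇝w)
    ... | inj₂ (inj₁ x≡v)            = contradiction x≡v x≢v
    ... | inj₂ (inj₂ (y , ny , x⇝y)) = inj₂ (inj₂ (y , ny , step u~x (edge-away-from-v u≢v x≢v e) x⇝y))

  Untouched : Fin n → Set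
  Untouched r = ¬ MonoPath G χ r v × (∀ y → NbrC y → ¬ MonoPath G χ r y)

  untouched-path : ∀ {r w} → Untouched r → MonoPath G χ′ r w → MonoPath G χ r w
  untouched-path (¬r⇝v , ¬meets) p with recoloured-path p
  ... | inj₁ r⇝w                 = r⇝w
  ... | inj₂ (inj₁ refl)         = contradiction here ¬r⇝v
  ... | inj₂ (inj₂ (y , ny , r⇝y)) = contradiction r⇝y (¬meets y ny)

  untouched-¬v : ∀ {r} → Untouched r → ¬ MonoPath G χ′ r v
  untouched-¬v ut p = proj₁ ut (untouched-path ut p)

  untouched-¬x₀ : ∀ {r} → Untouched r → ¬ MonoPath G χ′ r x₀
  untouched-¬x₀ ut p = proj₁ ut (_++ᵖ_ G χ (untouched-path ut p) (step (sym G v~x₀) χx₀≡χv here))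

  data Kind (r : Fin n) : Set where
    contains-v : MonoPath G χ r v → Kind r
    meets      : (y : Fin n) → NbrC y → MonoPath G χ r y → Kind r
    untouched  : Untouched r → Kind r

  kind : ∀ r → Kind r
  kind r with path? χ r v
  ... | yes r⇝v = contains-v r⇝v
  ... | no ¬r⇝v with any? (λ y → (adj? G v y ×-dec (χ y ≟ c)) ×-dec path? χ r y)
  ...   | yes (y , ny , r⇝y) = meets y ny r⇝y
  ...   | no ¬meets          = untouched (¬r⇝v , λ y ny r⇝y → ¬meets (y , ny , r⇝y))

  rep′ : Fin n → Fin n
  rep′ u = proj₁ (representative G path? χ′ u)

  to-rep′ : ∀ u → MonoPath G χ′ u (rep′ u)
  to-rep′ u = proj₁ (proj₂ (representative G path? χ′ u))

  rep′-isRep : ∀ u → IsRep G χ′ (rep′ u)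
  rep′-isRep u = proj₂ (proj₂ (representative G path? χ′ u))

  Target : Fin n ⊎ Fin n → Set
  Target (inj₁ x) = IsRep G χ′ x
  Target (inj₂ y) = NbrC y

  Target? : Decidable Target
  Target? (inj₁ x) = isRep? G path? χ′ x
  Target? (inj₂ y) = adj? G v y ×-dec (χ y ≟ c)

  image : ∀ {r} → Kind r → Fin n ⊎ Fin n
  image (contains-v _)    = inj₁ (rep′ x₀)
  image (meets y _ _)     = inj₂ y
  image {r} (untouched _) = inj₁ r

  image-target : ∀ {r} → IsRep G χ r → (k : Kind r) → Target (image k)
  image-target _   (contains-v _)  = rep′-isRep x₀
  image-target _   (meets _ ny _)  = ny
  image-target rep (untouched ut)  = λ w p → rep w (untouched-path ut p)

  image-injective : ∀ {r₁ r₂} → IsRep G χ r₁ → IsRep G χ r₂ → (k₁ : Kind r₁) (k₂ : Kind r₂) →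
    image k₁ ≡ image k₂ → r₁ ≡ r₂
  image-injective rep₁ rep₂ (contains-v p₁) (contains-v p₂) _ =
    rep-unique G χ rep₁ rep₂ (_++ᵖ_ G χ p₁ (reverse G χ p₂))
  image-injective rep₁ rep₂ (contains-v _) (untouched ut) refl =
    contradiction (reverse G χ′ (to-rep′ x₀)) (untouched-¬x₀ ut)
  image-injective rep₁ rep₂ (untouched ut) (contains-v _) refl =
    contradiction (reverse G χ′ (to-rep′ x₀)) (untouched-¬x₀ ut)
  image-injective rep₁ rep₂ (meets y _ q₁) (meets .y _ q₂) refl =
    rep-unique G χ rep₁ rep₂ (_++ᵖ_ G χ q₁ (reverse G χ q₂))
  image-injective rep₁ rep₂ (untouched _) (untouched _) refl = refl
  image-injective rep₁ rep₂ (contains-v _) (meets _ _ _) ()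
  image-injective rep₁ rep₂ (meets _ _ _) (contains-v _) ()
  image-injective rep₁ rep₂ (meets _ _ _) (untouched _) ()
  image-injective rep₁ rep₂ (untouched _) (meets _ _ _) ()

  image-misses-v : ∀ {r} (k : Kind r) → image k ≢ inj₁ (rep′ v)
  image-misses-v (contains-v _) e = c≢χv (begin
    c                  ≡⟨ ≡.sym (recolor-at χ v c) ⟩
    χ′ v               ≡⟨ path-colour G χ′ (to-rep′ v) ⟩
    χ′ (rep′ v)        ≡⟨ cong χ′ (inj₁-injective (≡.sym e)) ⟩
    χ′ (rep′ x₀)       ≡⟨ ≡.sym (path-colour G χ′ (to-rep′ x₀)) ⟩
    χ′ x₀              ≡⟨ recolor-elsewhere χ v c (λ x₀≡v → irrefl G (≡.subst (Adj G v) x₀≡v v~x₀)) ⟩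
    χ x₀               ≡⟨ χx₀≡χv ⟩
    χ v                ∎)
    where open ≡-Reasoning
  image-misses-v (meets _ _ _) ()
  image-misses-v (untouched ut) refl = untouched-¬v ut (reverse G χ′ (to-rep′ v))

  recolour-gain : 1 + Φ G path? χ ℕ.≤ Φ G path? χ′ + colourDegree G χ v c
  recolour-gain rewrite Φ-count G path? χ | Φ-count G path? χ′ =
    count-injection-avoiding-⊎ (isRep? G path? χ) Target? (image ∘ kind) (inj₁ (rep′ v))
      (λ {r} rep → image-target rep (kind r))
      (λ {r₁} {r₂} rep₁ rep₂ → image-injective rep₁ rep₂ (kind r₁) (kind r₂))
      (rep′-isRep v)
      (λ {r} _ → image-misses-v (kind r))

other-colours-bound : ∀ {n Δ} (G : Graph n) → (∀ u → degree G u ℕ.≤ Δ) →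
  (χ : Coloring n (suc Δ)) {v x₀ : Fin n} → Adj G v x₀ → χ x₀ ≡ χ v →
  ∑[ j < Δ ] colourDegree G χ v (punchIn (χ v) j) + 1 ℕ.≤ Δ
other-colours-bound {Δ = Δ} G deg≤Δ χ {v} {x₀} v~x₀ χx₀≡χv = begin
  M + 1                                     ≤⟨ ℕ.+-monoʳ-≤ M (count-pos (λ y → adj? G v y ×-dec (χ y ≟ χ v)) x₀ (v~x₀ , χx₀≡χv)) ⟩
  M + m (χ v)                               ≡⟨ ℕ.+-comm M (m (χ v)) ⟩
  m (χ v) + M                               ≡⟨ ≡.sym (sum-remove {i = χ v} m) ⟩
  ∑[ c < suc Δ ] m c                        ≡⟨ count-by-colour (adj? G v) χ ⟩
  count (adj? G v)                          ≡⟨ ≡.sym (count-length (adj? G v)) ⟩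
  degree G v                                ≤⟨ deg≤Δ v ⟩
  Δ                                         ∎
  where
  open ℕ.≤-Reasoning
  m : Fin (suc Δ) → ℕ
  m = colourDegree G χ v
  M : ℕ
  M = ∑[ j < Δ ] m (punchIn (χ v) j)

gain-arith : ∀ Δ Φ₀ S M → Δ * (1 + Φ₀) ℕ.≤ S + M → M + 1 ℕ.≤ Δ → Δ * Φ₀ + 1 ℕ.≤ S
gain-arith Δ Φ₀ S M sum-gain M<Δ = ℕ.+-cancelˡ-≤ M (Δ * Φ₀ + 1) S (begin
  M + (Δ * Φ₀ + 1)   ≡⟨ shuffle M (Δ * Φ₀) ⟩
  Δ * Φ₀ + (M + 1)   ≤⟨ ℕ.+-monoʳ-≤ (Δ * Φ₀) M<Δ ⟩
  Δ * Φ₀ + Δ         ≡⟨ distrib Δ Φ₀ ⟩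
  Δ * (1 + Φ₀)       ≤⟨ sum-gain ⟩
  S + M              ≡⟨ ℕ.+-comm S M ⟩
  M + S              ∎)
  where
  open ℕ.≤-Reasoning
  shuffle : ∀ x y → x + (y + 1) ≡ y + (x + 1)
  shuffle = ℕSolver.solve-∀
  distrib : ∀ x y → x * y + x ≡ x * (1 + y)
  distrib = ℕSolver.solve-∀

recolour-total-gain : ∀ {n Δ} (G : Graph n) → (∀ u → degree G u ℕ.≤ Δ) →
  (path? : PathDecider G (suc Δ)) (χ : Coloring n (suc Δ)) {v : Fin n} → Conflicted G χ v →
  suc Δ * Φ G path? χ + 1 ℕ.≤ ∑[ c < suc Δ ] Φ G path? (recolor χ v c)
recolour-total-gain {Δ = Δ} G deg≤Δ path? χ {v} (x₀ , v~x₀ , χx₀≡χv) = begin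
  suc Δ * Φ₀ + 1              ≡⟨ ℕ.+-assoc Φ₀ (Δ * Φ₀) 1 ⟩
  Φ₀ + (Δ * Φ₀ + 1)           ≤⟨ ℕ.+-monoʳ-≤ Φ₀ (gain-arith Δ Φ₀ S M sum-of-gains
                                    (other-colours-bound G deg≤Δ χ v~x₀ χx₀≡χv)) ⟩
  Φ₀ + S                      ≡⟨ cong (_+ S) (Φ-cong G path? (≡.sym ∘ recolor-own χ v)) ⟩
  Φ′ (χ v) + S                ≡⟨ ≡.sym (sum-remove {i = χ v} Φ′) ⟩
  ∑[ c < suc Δ ] Φ′ c         ∎
  where
  open ℕ.≤-Reasoning
  Φ₀ : ℕ
  Φ₀ = Φ G path? χ
  Φ′ m : Fin (suc Δ) → ℕ
  Φ′ c = Φ G path? (recolor χ v c)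
  m = colourDegree G χ v
  other : Fin Δ → Fin (suc Δ)
  other = punchIn (χ v)
  S M : ℕ
  S = ∑[ j < Δ ] Φ′ (other j)
  M = ∑[ j < Δ ] m (other j)
  sum-of-gains : Δ * (1 + Φ₀) ℕ.≤ S + M
  sum-of-gains = begin
    Δ * (1 + Φ₀)                          ≡⟨ ≡.sym (sum-const Δ (1 + Φ₀)) ⟩
    ∑[ j < Δ ] (1 + Φ₀)                   ≤⟨ sum-mono _ _ (λ j → RecolourStep.recolour-gain
                                               G path? χ v~x₀ χx₀≡χv (punchInᵢ≢i (χ v) j)) ⟩
    ∑[ j < Δ ] (Φ′ (other j) + m (other j)) ≡⟨ ∑-distrib-+ (Φ′ ∘ other) (m ∘ other) ⟩
    S + M                                 ∎

lemma4 : ∀ {n} (G : Graph n) (Δ : ℕ) → IsMaxDegree G Δ →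
    (path? : ∀ (χ : Coloring n (suc Δ)) u w → Dec (MonoPath G χ u w)) →
    (χ : Coloring n (suc Δ)) → ¬ Proper G χ →
    (v : Fin n) → Conflicted G χ v →
    + 1 ≤ sumColors (suc Δ) (λ c → + Φ G path? (recolor χ v c) - + Φ G path? χ)
lemma4 G Δ (deg≤Δ , _) path? χ _ v conflict =
  ≡.subst (+ 1 ≤_) (≡.sym (sumColors-diff (suc Δ) (λ c → Φ G path? (recolor χ v c)) (Φ G path? χ)))
    (pos-difference (recolour-total-gain G deg≤Δ path? χ conflict))
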